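{- Let $\sigma$ be a D-permutation of $[2n]$ and let $F=\{2,4,\dots,2n\}$, $F'=\{i:\sigma^{ -1}(i)\text{ even}\}$, $G=\{1,3,\dots,2n-1\}$, $G'=\{i:\sigma^{ -1}(i)\text{ odd}\}$. The Laguerre digraph $L|_F$ consists of the following connected components: loops on the even fixed points of $\sigma$; directed paths with at least two vertices, whose initial vertex is a cycle peak of $\sigma$ (i.e. lies in $F\cap G'$), whose final vertex is a cycle valley of $\sigma$ (i.e. lies in $F'\cap G$), and whose intermediate vertices (if any) are cycle double falls (which lie in $F\cap F'$); and isolated vertices at the $u\in G\cap G'$, i.e. the cycle double rises and odd fixed points of $\sigma$. Furthermore, $L|_F$ contains no directed cycles other than loops.
   Context: A D-permutation of $[2n]$ is a permutation $\sigma$ with $\sigma(2k-1)\ge2k-1$ and $\sigma(2k)\le2k$ for all $k$. For $S\subseteq[2n]$, $L|_S$ is the directed graph on vertex set $[2n]$ with edges $u\to\sigma(u)$ for $u\in S$. Cycle peak: $\sigma^{ -1}(i)<i>\sigma(i)$; cycle valley: $\sigma^{ -1}(i)>i<\sigma(i)$; cycle double rise: $\sigma^{ -1}(i)<i<\sigma(i)$; cycle double fall: $\sigma^{ -1}(i)>i>\sigma(i)$. -}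

module Defs where

open import Data.Nat using (ℕ; zero; suc; _*_; _<_; _≤_)
open import Data.Nat.Divisibility using (_∣_)
open import Data.Fin using (Fin; toℕ)
open import Data.Fin.Permutation using (Permutation′; _⟨$⟩ʳ_; _⟨$⟩ˡ_)
open import Data.List using (List; []; _∷_; _++_)
open import Data.List.Relation.Unary.All using (All)
open import Data.List.Relation.Unary.Linked using (Linked)
open import Data.List.Relation.Unary.Unique.Propositional using (Unique)
open import Data.List.Membership.Propositional using (_∈_)
open import Data.Product using (Σ; ∃; _×_)
open import Data.Sum using (_⊎_)
open import Relation.Nullary using (¬_)
open import Relation.Binary.PropositionalEquality using (_≡_)

-- Convention: the vertex set [2n] = {1,…,2n} is represented by Fin (2 * n);
-- the element i : Fin (2 * n) stands for the integer lab i = toℕ i + 1.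

module _ {n : ℕ} where

  V : Set
  V = Fin (2 * n)

  lab : V → ℕ
  lab i = suc (toℕ i)

  EvenV : V → Set
  EvenV i = 2 ∣ lab i

  OddV : V → Set
  OddV i = ¬ (2 ∣ lab i)

  module _ (σ : Permutation′ (2 * n)) where

    σ⁺ : V → V
    σ⁺ i = σ ⟨$⟩ʳ i

    σ⁻ : V → V
    σ⁻ i = σ ⟨$⟩ˡ i

    IsDPerm : Set
    IsDPerm = ∀ i → (OddV i → lab i ≤ lab (σ⁺ i)) × (EvenV i → lab (σ⁺ i) ≤ lab i)

    InF : V → Set
    InF i = EvenV i

    InF' : V → Set
    InF' i = EvenV (σ⁻ i)

    InG : V → Set
    InG i = OddV i

    InG' : V → Set
    InG' i = OddV (σ⁻ i)

    CyclePeak : V → Set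
    CyclePeak i = (lab (σ⁻ i) < lab i) × (lab (σ⁺ i) < lab i)

    CycleValley : V → Set
    CycleValley i = (lab i < lab (σ⁻ i)) × (lab i < lab (σ⁺ i))

    CycleDoubleRise : V → Set
    CycleDoubleRise i = (lab (σ⁻ i) < lab i) × (lab i < lab (σ⁺ i))

    CycleDoubleFall : V → Set
    CycleDoubleFall i = (lab i < lab (σ⁻ i)) × (lab (σ⁺ i) < lab i)

    EdgeLF : V → V → Set
    EdgeLF u v = InF u × σ⁺ u ≡ v

    data WalkLF : V → V → ℕ → Set where
      nil  : ∀ {u} → WalkLF u u zero
      cons : ∀ {u v w k} → EdgeLF u v → WalkLF v w k → WalkLF u w (suc k)

    IsolatedLF : V → Set
    IsolatedLF u = (∀ w → ¬ EdgeLF u w) × (∀ w → ¬ EdgeLF w u)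

    OnPathComponentLF : V → Set
    OnPathComponentLF u =
      Σ V λ v₀ → Σ (List V) λ ms → Σ V λ vₖ →
        let p = v₀ ∷ (ms ++ (vₖ ∷ [])) in
        Linked EdgeLF p × Unique p × u ∈ p
        × (∀ w → ¬ EdgeLF w v₀) × (∀ w → ¬ EdgeLF vₖ w)
        × (CyclePeak v₀ × InF v₀ × InG' v₀)
        × (CycleValley vₖ × InF' vₖ × InG vₖ)
        × All (λ m → CycleDoubleFall m × InF m × InF' m) ms

-- In a D-permutation an even vertex u has σ(u) ≤ u, so every non-loop edge
-- u → σ(u) of L|_F strictly lowers the label: closed walks are loops, and
-- from a non-fixed vertex one can only descend finitely often along F and
-- ascend finitely often along F'.  Every vertex has at most one out-edge
-- (present iff it lies in F) and at most one in-edge (present iff it lies in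
-- F'), so the component of a vertex that is not an even fixed point is
-- obtained by descending until leaving F (at a vertex of F' ∩ G) and
-- ascending until leaving F' (at a vertex of F ∩ G').  Comparing each vertex
-- with its predecessor and successor then identifies peaks, valleys, double
-- falls and double rises purely by the parities of i and σ⁻¹(i).
module Submission where

open import Defs
open import Data.Nat using (ℕ; suc; _*_; _<_; _≤_)
open import Data.Nat.Properties
  using (≤-refl; ≤-trans; ≤-antisym; <-trans; <-irrefl; ≤∧≢⇒<; ≤-pred; suc-injective)
open import Data.Nat.Divisibility using (_∣?_)
open import Data.Fin using (_≟_)
open import Data.Fin.Properties using (toℕ-injective)
open import Data.Fin.Induction using (<-wellFounded; >-wellFounded)
open import Data.Fin.Permutation using (Permutation′; inverseˡ; inverseʳ)
open import Data.List using (List; []; _∷_; _++_)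
open import Data.List.Properties using (++-assoc)
open import Data.List.Relation.Unary.All as All using (All; []; _∷_)
open import Data.List.Relation.Unary.All.Properties using (++⁺)
open import Data.List.Relation.Unary.AllPairs as AllPairs using ()
open import Data.List.Relation.Unary.Any using (here; there)
open import Data.List.Relation.Unary.Linked as Linked using (Linked; [-]; _∷_)
open import Data.List.Relation.Unary.Linked.Properties using (Linked⇒AllPairs)
open import Data.List.Relation.Unary.Unique.Propositional using (Unique)
open import Data.List.Membership.Propositional using (_∈_)
open import Data.List.Membership.Propositional.Properties using (∈-++⁺ˡ; ∈-++⁺ʳ)
open import Data.Product using (_×_; _,_; proj₁; proj₂)
open import Data.Sum using (_⊎_; inj₁; inj₂)
open import Function using (_∘_)
open import Induction.WellFounded using (Acc; acc)
open import Relation.Binary.Core using (Rel)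
open import Relation.Nullary using (yes; no)
open import Relation.Binary.PropositionalEquality
  using (_≡_; _≢_; refl; sym; trans; cong; subst)

descending⇒Unique : ∀ {a} {A : Set a} (f : A → ℕ) {xs : List A} →
                    Linked (λ x y → f y < f x) xs → Unique xs
descending⇒Unique f =
  AllPairs.map (λ { fy<fx refl → <-irrefl refl fy<fx })
  ∘ Linked⇒AllPairs (λ fy<fx fz<fy → <-trans fz<fy fy<fx)

Linked-++-shared : ∀ {a ℓ} {A : Set a} {R : Rel A ℓ} xs {x ys} →
                   Linked R (xs ++ x ∷ []) → Linked R (x ∷ ys) → Linked R (xs ++ x ∷ ys)
Linked-++-shared []           _              rest = rest
Linked-++-shared (_ ∷ [])     (r ∷ _)        rest = r ∷ rest
Linked-++-shared (_ ∷ y ∷ xs) (r ∷ linked)   rest = r ∷ Linked-++-shared (y ∷ xs) linked rest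

lab-injective : ∀ {n} {i j : V {n}} → lab {n} i ≡ lab {n} j → i ≡ j
lab-injective = toℕ-injective ∘ suc-injective

lab-≤∧≢⇒< : ∀ {n} {i j : V {n}} → lab {n} i ≤ lab {n} j → i ≢ j → lab {n} i < lab {n} j
lab-≤∧≢⇒< {n} i≤j i≢j = ≤∧≢⇒< i≤j (i≢j ∘ lab-injective {n})

even≢odd : ∀ {n} {i j : V {n}} → EvenV {n} i → OddV {n} j → i ≢ j
even≢odd even odd refl = odd even

module LaguerreF {n : ℕ} (σ : Permutation′ (2 * n)) (isD : IsDPerm {n} σ) where

  σ⁻σ⁺ : ∀ {i} → σ⁻ {n} σ (σ⁺ {n} σ i) ≡ i
  σ⁻σ⁺ = inverseˡ σ

  σ⁺σ⁻ : ∀ {i} → σ⁺ {n} σ (σ⁻ {n} σ i) ≡ i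
  σ⁺σ⁻ = inverseʳ σ

  Moved : V {n} → Set
  Moved i = σ⁺ {n} σ i ≢ i

  σ⁻≢⇒moved : ∀ {i} → σ⁻ {n} σ i ≢ i → Moved i
  σ⁻≢⇒moved σ⁻i≢i fixed = σ⁻i≢i (trans (cong (σ⁻ {n} σ) (sym fixed)) σ⁻σ⁺)

  moved-σ⁺ : ∀ {i} → Moved i → Moved (σ⁺ {n} σ i)
  moved-σ⁺ moved = σ⁻≢⇒moved (λ e → moved (trans (sym e) σ⁻σ⁺))

  moved⇒σ⁻≢ : ∀ {i} → Moved i → σ⁻ {n} σ i ≢ i
  moved⇒σ⁻≢ moved σ⁻i≡i = moved (trans (cong (σ⁺ {n} σ) (sym σ⁻i≡i)) σ⁺σ⁻)

  moved-σ⁻ : ∀ {i} → Moved i → Moved (σ⁻ {n} σ i)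
  moved-σ⁻ moved e = moved⇒σ⁻≢ moved (trans (sym e) σ⁺σ⁻)

  edge-source : ∀ {w u} → EdgeLF {n} σ w u → w ≡ σ⁻ {n} σ u
  edge-source (_ , σw≡u) = trans (sym σ⁻σ⁺) (cong (σ⁻ {n} σ) σw≡u)

  InF⇒InF'-σ⁺ : ∀ {i} → InF {n} σ i → InF' {n} σ (σ⁺ {n} σ i)
  InF⇒InF'-σ⁺ = subst (EvenV {n}) (sym σ⁻σ⁺)

  even-descends : ∀ {i} → InF {n} σ i → lab {n} (σ⁺ {n} σ i) ≤ lab {n} i
  even-descends = proj₂ (isD _)

  odd-ascends : ∀ {i} → InG {n} σ i → lab {n} i ≤ lab {n} (σ⁺ {n} σ i)
  odd-ascends = proj₁ (isD _)

  even-moved-descends : ∀ {i} → InF {n} σ i → Moved i → lab {n} (σ⁺ {n} σ i) < lab {n} i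
  even-moved-descends even = lab-≤∧≢⇒< {n} (even-descends even)

  odd-moved-ascends : ∀ {i} → InG {n} σ i → Moved i → lab {n} i < lab {n} (σ⁺ {n} σ i)
  odd-moved-ascends odd moved = lab-≤∧≢⇒< {n} (odd-ascends odd) (moved ∘ sym)

  pred-even-ascends : ∀ {i} → InF' {n} σ i → Moved i → lab {n} i < lab {n} (σ⁻ {n} σ i)
  pred-even-ascends even moved =
    subst (λ j → lab {n} j < lab {n} (σ⁻ {n} σ _)) σ⁺σ⁻ (even-moved-descends even (moved-σ⁻ moved))

  pred-odd-descends : ∀ {i} → InG' {n} σ i → Moved i → lab {n} (σ⁻ {n} σ i) < lab {n} i
  pred-odd-descends odd moved =
    subst (λ j → lab {n} (σ⁻ {n} σ _) < lab {n} j) σ⁺σ⁻ (odd-moved-ascends odd (moved-σ⁻ moved))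

  peak : ∀ {i} → InF {n} σ i → InG' {n} σ i → CyclePeak {n} σ i
  peak even odd = pred-odd-descends odd moved , even-moved-descends even moved
    where moved = σ⁻≢⇒moved (λ e → even≢odd {n} even odd (sym e))

  valley : ∀ {i} → InG {n} σ i → InF' {n} σ i → CycleValley {n} σ i
  valley odd even = pred-even-ascends even moved , odd-moved-ascends odd moved
    where moved = σ⁻≢⇒moved (even≢odd {n} even odd)

  doubleFall : ∀ {i} → InF {n} σ i → InF' {n} σ i → Moved i → CycleDoubleFall {n} σ i
  doubleFall even even' moved = pred-even-ascends even' moved , even-moved-descends even moved

  doubleRise : ∀ {i} → InG {n} σ i → InG' {n} σ i → Moved i → CycleDoubleRise {n} σ i
  doubleRise odd odd' moved = pred-odd-descends odd' moved , odd-moved-ascends odd moved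

  G∩G'-isolated : ∀ u → InG {n} σ u → InG' {n} σ u → IsolatedLF {n} σ u
  G∩G'-isolated u odd odd' =
    (λ _ edge → odd (proj₁ edge)) ,
    (λ _ edge → odd' (subst (EvenV {n}) (edge-source edge) (proj₁ edge)))

  walk-descends : ∀ {u w k} → WalkLF {n} σ u w k → lab {n} w ≤ lab {n} u
  walk-descends nil                      = ≤-refl
  walk-descends (cons (even , refl) walk) = ≤-trans (walk-descends walk) (even-descends even)

  closed-walk⇒loop : ∀ u k → WalkLF {n} σ u u (suc k) → EdgeLF {n} σ u u
  closed-walk⇒loop u k (cons (even , σu≡v) walk) =
    even , lab-injective {n} (≤-antisym (even-descends even) u≤σu)
    where
    u≤σu : lab {n} u ≤ lab {n} (σ⁺ {n} σ u)
    u≤σu = subst (λ v → lab {n} u ≤ lab {n} v) (sym σu≡v) (walk-descends walk)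

  Step : V {n} → V {n} → Set
  Step i j = EdgeLF {n} σ i j × lab {n} j < lab {n} i

  step-from : ∀ {i} → InF {n} σ i → Moved i → Step i (σ⁺ {n} σ i)
  step-from even moved = (even , refl) , even-moved-descends even moved

  step-into : ∀ {i} → InF' {n} σ i → Moved i → Step (σ⁻ {n} σ i) i
  step-into even moved = subst (Step (σ⁻ {n} σ _)) σ⁺σ⁻ (step-from even (moved-σ⁻ moved))

  PathStart PathInner PathEnd : V {n} → Set
  PathStart i = InF {n} σ i × InG' {n} σ i
  PathInner i = InF {n} σ i × InF' {n} σ i × Moved i
  PathEnd   i = InG {n} σ i × InF' {n} σ i

  record DescentFrom (i : V {n}) : Set where
    constructor descent
    field
      inner    : List (V {n})
      end      : V {n}
      steps    : Linked Step (i ∷ inner ++ end ∷ [])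
      allInner : All PathInner inner
      isEnd    : PathEnd end

  record AscentTo (i : V {n}) : Set where
    constructor ascent
    field
      start    : V {n}
      inner    : List (V {n})
      steps    : Linked Step (start ∷ inner ++ i ∷ [])
      isStart  : PathStart start
      allInner : All PathInner inner

  descend : ∀ i → InF {n} σ i → Moved i → DescentFrom i
  descend i = go i (<-wellFounded i)
    where
    go : ∀ i → Acc Data.Fin._<_ i → InF {n} σ i → Moved i → DescentFrom i
    go i (acc rec) even moved with 2 ∣? lab {n} (σ⁺ {n} σ i)
    ... | no odd =
            descent [] (σ⁺ {n} σ i) (step-from even moved ∷ [-]) [] (odd , InF⇒InF'-σ⁺ even)
    ... | yes even⁺
      with go (σ⁺ {n} σ i) (rec (≤-pred (even-moved-descends even moved))) even⁺ (moved-σ⁺ moved)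
    ...   | descent inner end steps allInner isEnd =
            descent (σ⁺ {n} σ i ∷ inner) end (step-from even moved ∷ steps)
                    ((even⁺ , InF⇒InF'-σ⁺ even , moved-σ⁺ moved) ∷ allInner) isEnd

  ascend : ∀ i → InF' {n} σ i → Moved i → AscentTo i
  ascend i = go i (>-wellFounded i)
    where
    go : ∀ i → Acc Data.Fin._>_ i → InF' {n} σ i → Moved i → AscentTo i
    go i (acc rec) even moved with 2 ∣? lab {n} (σ⁻ {n} σ (σ⁻ {n} σ i))
    ... | no odd = ascent (σ⁻ {n} σ i) [] (step-into even moved ∷ [-]) (even , odd) []
    ... | yes even⁻
      with go (σ⁻ {n} σ i) (rec (≤-pred (pred-even-ascends even moved))) even⁻ (moved-σ⁻ moved)
    ...   | ascent start inner steps isStart allInner =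
            ascent start (inner ++ σ⁻ {n} σ i ∷ [])
                   (subst (Linked Step ∘ (start ∷_)) (sym (++-assoc inner _ _))
                          (Linked-++-shared (start ∷ inner) steps (step-into even moved ∷ [-])))
                   isStart (++⁺ allInner ((even , even⁻ , moved-σ⁻ moved) ∷ []))

  path-component : ∀ {u} start inner end →
                   let p = start ∷ inner ++ end ∷ [] in
                   Linked Step p → u ∈ p →
                   PathStart start → All PathInner inner → PathEnd end →
                   OnPathComponentLF {n} σ u
  path-component start inner end steps u∈p (even , odd') allInner (odd , even') =
    start , inner , end ,
    Linked.map proj₁ steps , descending⇒Unique (lab {n}) (Linked.map proj₂ steps) , u∈p ,
    (λ _ edge → odd' (subst (EvenV {n}) (edge-source edge) (proj₁ edge))) ,
    (λ _ edge → odd (proj₁ edge)) ,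
    (peak even odd' , even , odd') ,
    (valley odd even' , even' , odd) ,
    All.map (λ { (e , e' , m) → doubleFall e e' m , e , e' }) allInner

  start-on-path : ∀ {u} → PathStart u → DescentFrom u → OnPathComponentLF {n} σ u
  start-on-path {u} isStart (descent inner end steps allInner isEnd) =
    path-component u inner end steps (here refl) isStart allInner isEnd

  end-on-path : ∀ {u} → AscentTo u → PathEnd u → OnPathComponentLF {n} σ u
  end-on-path {u} (ascent start inner steps isStart allInner) isEnd =
    path-component start inner u steps (there (∈-++⁺ʳ inner (here refl))) isStart allInner isEnd

  inner-on-path : ∀ {u} → AscentTo u → PathInner u → DescentFrom u → OnPathComponentLF {n} σ u
  inner-on-path {u} (ascent start inner₁ steps₁ isStart allInner₁) isInner
                    (descent inner₂ end steps₂ allInner₂ isEnd) =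
    path-component start (inner₁ ++ u ∷ inner₂) end
      (subst (Linked Step ∘ (start ∷_)) (sym (++-assoc inner₁ (u ∷ inner₂) (end ∷ [])))
             (Linked-++-shared (start ∷ inner₁) steps₁ steps₂))
      (there (∈-++⁺ˡ (∈-++⁺ʳ inner₁ (here refl))))
      isStart (++⁺ allInner₁ (isInner ∷ allInner₂)) isEnd

  component : ∀ u →
      ((EvenV {n} u × σ⁺ {n} σ u ≡ u) × EdgeLF {n} σ u u)
    ⊎ (((InG {n} σ u × InG' {n} σ u) × (CycleDoubleRise {n} σ u ⊎ (OddV {n} u × σ⁺ {n} σ u ≡ u)))
       × IsolatedLF {n} σ u)
    ⊎ OnPathComponentLF {n} σ u
  component u with 2 ∣? lab {n} u | 2 ∣? lab {n} (σ⁻ {n} σ u) | σ⁺ {n} σ u ≟ u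
  ... | yes even | _         | yes fixed = inj₁ ((even , fixed) , (even , fixed))
  ... | yes even | no odd'   | no moved  =
    inj₂ (inj₂ (start-on-path (even , odd') (descend u even moved)))
  ... | yes even | yes even' | no moved  =
    inj₂ (inj₂ (inner-on-path (ascend u even' moved) (even , even' , moved) (descend u even moved)))
  ... | no odd   | yes even' | _         =
    inj₂ (inj₂ (end-on-path (ascend u even' moved) (odd , even')))
    where moved = σ⁻≢⇒moved (even≢odd {n} even' odd)
  ... | no odd   | no odd'   | yes fixed =
    inj₂ (inj₁ (((odd , odd') , inj₂ (odd , fixed)) , G∩G'-isolated u odd odd'))
  ... | no odd   | no odd'   | no moved  =
    inj₂ (inj₁ (((odd , odd') , inj₁ (doubleRise odd odd' moved)) , G∩G'-isolated u odd odd'))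

lemma7p4 : (n : ℕ) (σ : Permutation′ (2 * n)) → IsDPerm {n} σ →
    (∀ u → ((EvenV {n} u × σ⁺ {n} σ u ≡ u) × EdgeLF {n} σ u u)
         ⊎ (((InG {n} σ u × InG' {n} σ u) × (CycleDoubleRise {n} σ u ⊎ (OddV {n} u × σ⁺ {n} σ u ≡ u)))
            × IsolatedLF {n} σ u)
         ⊎ OnPathComponentLF {n} σ u)
    × (∀ u → EvenV {n} u → σ⁺ {n} σ u ≡ u → EdgeLF {n} σ u u)
    × (∀ u → InG {n} σ u → InG' {n} σ u → IsolatedLF {n} σ u)
    × (∀ u k → WalkLF {n} σ u u (suc k) → EdgeLF {n} σ u u)
lemma7p4 n σ isD =
  component , (λ u even fixed → even , fixed) , G∩G'-isolated , closed-walk⇒loop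
  where open LaguerreF {n} σ isD
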